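{- Let $h_1,h_2,h_3,h_4\in\mathbb{N}$ with $h_1h_3=h_2h_4$, and let $v=(h_1h_3)^2+1$. In $\mathbb{Z}_v$ let $$A=\bigcup_{i=0}^{h_3-1}\{ih_1h_2+\alpha: 0\le\alpha\le h_1-1\},\qquad B=\bigcup_{i=0}^{h_4-1}\{ih_1h_2h_3+h_1h_2(h_3-1)+\beta h_1: 1\le\beta\le h_2\}.$$ Then $\{A,B\}$ is a classical $((h_1h_3)^2+1,2,h_1h_3,1)$-SEDF in $\mathbb{Z}_v$.
   Context: For subsets $A,B$ of an additively written group $G$, $\Delta(A,B)$ denotes the multiset $\{a-b:a\in A,b\in B\}$ (one entry per pair). For a set $S$ and $\lambda\in\mathbb{N}$, $\lambda S$ is the multiset of $\lambda$ copies of $S$. For a group $G$ of order $v$ and $m>1$, a classical $(v,m,k,\lambda)$-SEDF is a family of pairwise disjoint $k$-subsets $A_1,\dots,A_m$ of $G$ such that for each $i$, the multiset union $\bigcup_{j\ne i}\Delta(A_i,A_j)$ equals $\lambda(G\setminus\{0\})$. -}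

module Defs where

open import Data.Nat using (ℕ; zero; suc; _+_; _*_; _∸_; _<_; NonZero)
open import Data.Nat.DivMod using (_%_)
open import Data.Fin using (Fin; _≟_)
open import Data.List using (List; []; map; concat; concatMap; upTo; length; replicate; allFin)
open import Data.List.Membership.Propositional using (_∈_)
open import Data.List.Relation.Unary.Unique.Propositional using (Unique)
open import Data.List.Relation.Binary.Permutation.Propositional using (_↭_)
open import Data.Vec using (Vec; lookup)
open import Data.Bool using (if_then_else_)
open import Data.Product using (_×_)
open import Relation.Nullary using (¬_; does)
open import Relation.Binary.PropositionalEquality using (_≡_; _≢_)

-- The cyclic group ℤ_v is modelled by ℕ with arithmetic mod v; the canonical
-- representative of a residue x is x % v (an element of {0,…,v-1}).
-- A subset of ℤ_v is given by a list of natural-number representatives.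

subℤ : (v : ℕ) → .{{NonZero v}} → ℕ → ℕ → ℕ
subℤ v a b = (a % v + (v ∸ b % v)) % v

Δ : (v : ℕ) → .{{NonZero v}} → List ℕ → List ℕ → List ℕ
Δ v A B = concatMap (λ a → map (λ b → subℤ v a b) B) A

nonzeroℤ : ℕ → List ℕ
nonzeroℤ v = map suc (upTo (v ∸ 1))

IsKSubset : (v : ℕ) → .{{NonZero v}} → ℕ → List ℕ → Set
IsKSubset v k A = (length A ≡ k) × Unique (map (λ x → x % v) A)

DisjointZ : (v : ℕ) → .{{NonZero v}} → List ℕ → List ℕ → Set
DisjointZ v A B = ∀ {a b} → a ∈ A → b ∈ B → a % v ≢ b % v

otherDiffs : (v : ℕ) → .{{NonZero v}} → {m : ℕ} → Vec (List ℕ) m → Fin m → List ℕ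
otherDiffs v {m} F i =
  concat (map (λ j → if does (i ≟ j) then [] else Δ v (lookup F i) (lookup F j)) (allFin m))

IsClassicalSEDF : (v m k lam : ℕ) → .{{NonZero v}} → Vec (List ℕ) m → Set
IsClassicalSEDF v m k lam F =
  (1 < m)
  × (∀ i → IsKSubset v k (lookup F i))
  × (∀ i j → i ≢ j → DisjointZ v (lookup F i) (lookup F j))
  × (∀ i → otherDiffs v F i ↭ concat (replicate lam (nonzeroℤ v)))

setA : ℕ → ℕ → ℕ → List ℕ
setA h₁ h₂ h₃ = concatMap (λ i → map (λ α → i * h₁ * h₂ + α) (upTo h₁)) (upTo h₃)

setB : ℕ → ℕ → ℕ → ℕ → List ℕ
setB h₁ h₂ h₃ h₄ =
  concatMap (λ i → map (λ β → i * h₁ * h₂ * h₃ + h₁ * h₂ * (h₃ ∸ 1) + β * h₁)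
                       (map suc (upTo h₂)))
            (upTo h₄)

-- Write a = i h₁h₂ + α ∈ A and b = j h₁h₂h₃ + h₁h₂(h₃ − 1) + β h₁ ∈ B (1 ≤ β ≤ h₂).
-- Then b − a − 1 = j h₁h₂h₃ + (h₃ − 1 − i) h₁h₂ + (β − 1) h₁ + (h₁ − 1 − α) is a
-- mixed-radix numeral with digits below h₄, h₃, h₂, h₁, so as integers the differences
-- b − a run through 1, …, h₁h₂h₃h₄ = (h₁h₃)² = v − 1, each exactly once: Δ(B,A) is
-- G ∖ {0}.  Since Δ(A,B) = −Δ(B,A) and negation permutes G ∖ {0}, so is Δ(A,B).
-- Finally, |A||B| distinct nonzero differences force A and B to be disjoint sets.
module Submission where

open import Defs
open import Data.Nat using (ℕ; suc; _*_; _^_)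
open import Data.Vec using (_∷_; [])
open import Relation.Binary.PropositionalEquality using (_≡_)

open import Data.Fin using (zero; suc)
open import Function using (_∘_)
open import Data.List using (List; []; _∷_; _++_; [_]; map; concat; concatMap; upTo; downFrom; reverse; replicate; length)
open import Data.List.Membership.Propositional using (_∈_; _∉_)
open import Data.List.Membership.Propositional.Properties using (∈-map⁺; ∈-map⁻; ∈-concatMap⁺)
open import Data.List.Properties
  using (map-∘; map-cong; map-cong-local; map-id; map-++; map-concatMap; map-upTo;
         concatMap-cong; concatMap-map; concatMap-++; concatMap-pure; length-++; length-map; length-upTo;
         reverse-upTo; ++-assoc)
import Data.List.Relation.Binary.Permutation.Propositional as Perm
open Perm using (_↭_; ↭-refl; ↭-reflexive; ↭-sym; ↭-trans; ↭⇒↭ₛ; module PermutationReasoning)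
open import Data.List.Relation.Binary.Permutation.Propositional.Properties
  using (++⁺; ++⁺ˡ; ++⁺ʳ; shifts; map⁺; ↭-reverse; ∈-resp-↭)
import Data.List.Relation.Binary.Permutation.Setoid.Properties as PermSetoid
open import Data.List.Relation.Unary.All as All using ()
open import Data.List.Relation.Unary.All.Properties using (all-upTo; ++⁻ˡ)
open import Data.List.Relation.Unary.Any as Any using ()
open import Data.List.Relation.Unary.Unique.Propositional using (Unique; []; _∷_)
import Data.List.Relation.Unary.Unique.Propositional.Properties as Unique
open import Data.Nat using (zero; _+_; _∸_; _<_; _≤_; z<s; s≤s; z≤n; NonZero; >-nonZero⁻¹)
open import Data.Nat.DivMod
  using (_%_; %-distribˡ-+; m%n%n≡m%n; m%n<n; m%n≤n; m<n⇒m%n≡m; m≤n⇒m%n≡m; n%n≡0; [m+n]%n≡m%n)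
open import Data.Nat.Properties
open import Algebra.Properties.CommutativeSemigroup +-commutativeSemigroup using (x∙yz≈y∙xz)
open import Data.Nat.Tactic.RingSolver using (solve-∀)
open import Data.Product using (_,_)
open import Data.Sum using (inj₁; inj₂)
open import Data.Vec using (lookup)
open import Relation.Binary.PropositionalEquality
  using (_≢_; refl; sym; trans; cong; cong₂; subst; setoid; module ≡-Reasoning)
open import Relation.Nullary using (contradiction)

private
  variable
    A B C : Set

concatMap⁺ : ∀ (f : A → List B) {xs ys} → xs ↭ ys → concatMap f xs ↭ concatMap f ys
concatMap⁺ f Perm.refl         = ↭-refl
concatMap⁺ f (Perm.prep x p)   = ++⁺ˡ (f x) (concatMap⁺ f p)
concatMap⁺ f (Perm.swap x y p) =
  ↭-trans (shifts (f x) (f y)) (++⁺ˡ (f y) (++⁺ˡ (f x) (concatMap⁺ f p)))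
concatMap⁺ f (Perm.trans p q)  = ↭-trans (concatMap⁺ f p) (concatMap⁺ f q)

concatMap-cong-↭ : ∀ {f g : A → List B} → (∀ x → f x ↭ g x) →
                   ∀ xs → concatMap f xs ↭ concatMap g xs
concatMap-cong-↭ f↭g []       = ↭-refl
concatMap-cong-↭ f↭g (x ∷ xs) = ++⁺ (f↭g x) (concatMap-cong-↭ f↭g xs)

concatMap-++-↭ : ∀ (f g : A → List B) xs →
                 concatMap f xs ++ concatMap g xs ↭ concatMap (λ x → f x ++ g x) xs
concatMap-++-↭ f g []       = ↭-refl
concatMap-++-↭ f g (x ∷ xs) = begin
  (f x ++ concatMap f xs) ++ g x ++ concatMap g xs  ≡⟨ ++-assoc (f x) _ _ ⟩
  f x ++ concatMap f xs ++ g x ++ concatMap g xs    ↭⟨ ++⁺ˡ (f x) (shifts (concatMap f xs) (g x)) ⟩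
  f x ++ g x ++ concatMap f xs ++ concatMap g xs    ↭⟨ ++⁺ˡ (f x) (++⁺ˡ (g x) (concatMap-++-↭ f g xs)) ⟩
  f x ++ g x ++ concatMap (λ x → f x ++ g x) xs     ≡⟨ ++-assoc (f x) (g x) _ ⟨
  (f x ++ g x) ++ concatMap (λ x → f x ++ g x) xs   ∎
  where open PermutationReasoning

concatMap-concatMap : ∀ (g : B → List C) (f : A → List B) xs →
                      concatMap g (concatMap f xs) ≡ concatMap (λ x → concatMap g (f x)) xs
concatMap-concatMap g f []       = refl
concatMap-concatMap g f (x ∷ xs) =
  trans (concatMap-++ g (f x) (concatMap f xs)) (cong (concatMap g (f x) ++_) (concatMap-concatMap g f xs))

concatMap-comm-↭ : ∀ (f : A → B → List C) xs ys →
                   concatMap (λ x → concatMap (f x) ys) xs ↭ concatMap (λ y → concatMap (λ x → f x y) xs) ys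
concatMap-comm-↭ f []       ys = ↭-reflexive (sym (concatMap-[] ys))
  where
  concatMap-[] : ∀ (ys : List B) → concatMap {B = C} (λ _ → []) ys ≡ []
  concatMap-[] []       = refl
  concatMap-[] (_ ∷ ys) = concatMap-[] ys
concatMap-comm-↭ f (x ∷ xs) ys =
  ↭-trans (++⁺ˡ (concatMap (f x) ys) (concatMap-comm-↭ f xs ys)) (concatMap-++-↭ (f x) _ ys)

concatMap-map-comm-↭ : ∀ (f : A → B → C) xs ys →
                       concatMap (λ x → map (f x) ys) xs ↭ concatMap (λ y → map (λ x → f x y) xs) ys
concatMap-map-comm-↭ f xs ys = begin
  concatMap (λ x → map (f x) ys) xs                      ≡⟨ concatMap-cong (λ x → map-singletons (f x) ys) xs ⟩
  concatMap (λ x → concatMap (λ y → [ f x y ]) ys) xs    ↭⟨ concatMap-comm-↭ (λ x y → [ f x y ]) xs ys ⟩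
  concatMap (λ y → concatMap (λ x → [ f x y ]) xs) ys    ≡⟨ concatMap-cong (λ y → map-singletons (λ x → f x y) xs) ys ⟨
  concatMap (λ y → map (λ x → f x y) xs) ys              ∎
  where
  open PermutationReasoning
  map-singletons : ∀ {X : Set} (h : X → C) zs → map h zs ≡ concatMap (λ z → [ h z ]) zs
  map-singletons h zs = trans (sym (concatMap-pure (map h zs))) (concatMap-map [_] h zs)

length-concatMap-map : ∀ (f : A → B → C) xs ys →
                       length (concatMap (λ x → map (f x) ys) xs) ≡ length xs * length ys
length-concatMap-map f []       ys = refl
length-concatMap-map f (x ∷ xs) ys =
  trans (length-++ (map (f x) ys)) (cong₂ _+_ (length-map (f x) ys) (length-concatMap-map f xs ys))

Unique-++⁻ˡ : ∀ (xs : List A) {ys} → Unique (xs ++ ys) → Unique xs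
Unique-++⁻ˡ []       _           = []
Unique-++⁻ˡ (x ∷ xs) (x∉ ∷ uniq) = ++⁻ˡ xs x∉ ∷ Unique-++⁻ˡ xs uniq

Unique-resp-↭ : ∀ {xs ys : List ℕ} → xs ↭ ys → Unique xs → Unique ys
Unique-resp-↭ xs↭ys = PermSetoid.Unique-resp-↭ (setoid ℕ) (↭⇒↭ₛ xs↭ys)

map-cong-upTo : ∀ {f g : ℕ → A} k → (∀ {x} → x < k → f x ≡ g x) → map f (upTo k) ≡ map g (upTo k)
map-cong-upTo k f≡g = map-cong-local (All.map f≡g (all-upTo k))

concatMap-cong-upTo : ∀ {f g : ℕ → List A} k → (∀ {x} → x < k → f x ≡ g x) →
                      concatMap f (upTo k) ≡ concatMap g (upTo k)
concatMap-cong-upTo k f≡g = cong concat (map-cong-upTo k f≡g)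

upTo-suc : ∀ k → upTo (suc k) ≡ 0 ∷ map suc (upTo k)
upTo-suc k = cong (0 ∷_) (sym (map-upTo suc k))

upTo-+ : ∀ m n → upTo (m + n) ≡ upTo m ++ map (m +_) (upTo n)
upTo-+ zero    n = sym (map-id (upTo n))
upTo-+ (suc m) n = begin
  upTo (suc (m + n))                                      ≡⟨ upTo-suc (m + n) ⟩
  0 ∷ map suc (upTo (m + n))                              ≡⟨ cong (λ xs → 0 ∷ map suc xs) (upTo-+ m n) ⟩
  0 ∷ map suc (upTo m ++ map (m +_) (upTo n))             ≡⟨ cong (0 ∷_) (map-++ suc (upTo m) _) ⟩
  0 ∷ map suc (upTo m) ++ map suc (map (m +_) (upTo n))   ≡⟨ cong (λ xs → 0 ∷ map suc (upTo m) ++ xs) (map-∘ (upTo n)) ⟨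
  0 ∷ map suc (upTo m) ++ map (suc m +_) (upTo n)         ≡⟨ cong (_++ map (suc m +_) (upTo n)) (upTo-suc m) ⟨
  upTo (suc m) ++ map (suc m +_) (upTo n)                 ∎
  where open ≡-Reasoning

concatMap-upTo-* : ∀ (g : ℕ → A) m k →
                   concatMap (λ i → map (λ x → g (i * m + x)) (upTo m)) (upTo k) ≡ map g (upTo (k * m))
concatMap-upTo-* g m zero    = refl
concatMap-upTo-* g m (suc k) = begin
  concatMap digit (upTo (suc k))                                            ≡⟨ cong (concatMap digit) (upTo-suc k) ⟩
  map g (upTo m) ++ concatMap digit (map suc (upTo k))                      ≡⟨ cong (map g (upTo m) ++_) (concatMap-map digit suc (upTo k)) ⟩
  map g (upTo m) ++ concatMap (λ i → digit (suc i)) (upTo k)                ≡⟨ cong (map g (upTo m) ++_) (concatMap-cong shift (upTo k)) ⟩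
  map g (upTo m) ++ concatMap (λ i → map (λ x → g (m + (i * m + x))) (upTo m)) (upTo k)
                                                                            ≡⟨ cong (map g (upTo m) ++_) (concatMap-upTo-* (λ y → g (m + y)) m k) ⟩
  map g (upTo m) ++ map (λ y → g (m + y)) (upTo (k * m))                    ≡⟨ cong (map g (upTo m) ++_) (map-∘ (upTo (k * m))) ⟩
  map g (upTo m) ++ map g (map (m +_) (upTo (k * m)))                       ≡⟨ map-++ g (upTo m) _ ⟨
  map g (upTo m ++ map (m +_) (upTo (k * m)))                               ≡⟨ cong (map g) (upTo-+ m (k * m)) ⟨
  map g (upTo (suc k * m))                                                  ∎
  where
  open ≡-Reasoning
  digit : ℕ → List _
  digit i = map (λ x → g (i * m + x)) (upTo m)
  shift : ∀ i → digit (suc i) ≡ map (λ x → g (m + (i * m + x))) (upTo m)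
  shift i = map-cong (λ x → cong g (+-assoc m (i * m) x)) (upTo m)

map-reflect-upTo : ∀ k → map (λ x → k ∸ suc x) (upTo k) ≡ downFrom k
map-reflect-upTo zero    = refl
map-reflect-upTo (suc k) = begin
  map (λ x → suc k ∸ suc x) (upTo (suc k))          ≡⟨ cong (map _) (upTo-suc k) ⟩
  k ∷ map (λ x → suc k ∸ suc x) (map suc (upTo k))  ≡⟨ cong (k ∷_) (map-∘ (upTo k)) ⟨
  k ∷ map (λ x → k ∸ suc x) (upTo k)                ≡⟨ cong (k ∷_) (map-reflect-upTo k) ⟩
  downFrom (suc k)                                  ∎
  where open ≡-Reasoning

upTo-reflect-↭ : ∀ k → map (λ x → k ∸ suc x) (upTo k) ↭ upTo k
upTo-reflect-↭ k = begin
  map (λ x → k ∸ suc x) (upTo k)  ≡⟨ map-reflect-upTo k ⟩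
  downFrom k                      ≡⟨ reverse-upTo k ⟨
  reverse (upTo k)                ↭⟨ ↭-reverse (upTo k) ⟩
  upTo k                          ∎
  where open PermutationReasoning

map-reflect-↭ : ∀ (f : ℕ → A) k → map (λ x → f (k ∸ suc x)) (upTo k) ↭ map f (upTo k)
map-reflect-↭ f k = ↭-trans (↭-reflexive (map-∘ (upTo k))) (map⁺ f (upTo-reflect-↭ k))

concatMap-reflect-↭ : ∀ (f : ℕ → List A) k → concatMap (λ x → f (k ∸ suc x)) (upTo k) ↭ concatMap f (upTo k)
concatMap-reflect-↭ f k =
  ↭-trans (↭-reflexive (sym (concatMap-map f _ (upTo k)))) (concatMap⁺ f (upTo-reflect-↭ k))

[m%n+k]%n≡[m+k]%n : ∀ m k n .{{_ : NonZero n}} → (m % n + k) % n ≡ (m + k) % n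
[m%n+k]%n≡[m+k]%n m k n = begin
  (m % n + k) % n          ≡⟨ %-distribˡ-+ (m % n) k n ⟩
  (m % n % n + k % n) % n  ≡⟨ cong (λ r → (r + k % n) % n) (m%n%n≡m%n m n) ⟩
  (m % n + k % n) % n      ≡⟨ %-distribˡ-+ m k n ⟨
  (m + k) % n              ∎
  where open ≡-Reasoning

-- −d in ℤ_v, for a representative d < v.
negℤ : (v : ℕ) → .{{NonZero v}} → ℕ → ℕ
negℤ v d = (v ∸ d) % v

module _ (v : ℕ) .{{_ : NonZero v}} where

  subℤ<v : ∀ a b → subℤ v a b < v
  subℤ<v a b = m%n<n _ v

  subℤ-% : ∀ a b → subℤ v (a % v) (b % v) ≡ subℤ v a b
  subℤ-% a b = cong₂ (λ x y → (x + (v ∸ y)) % v) (m%n%n≡m%n a v) (m%n%n≡m%n b v)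

  subℤ-+ : ∀ a s → subℤ v (a + s) a ≡ s % v
  subℤ-+ a s = begin
    ((a + s) % v + (v ∸ a % v)) % v  ≡⟨ [m%n+k]%n≡[m+k]%n (a + s) (v ∸ a % v) v ⟩
    (a + s + (v ∸ a % v)) % v        ≡⟨ cong (_% v) (+-assoc a s _) ⟩
    (a + (s + (v ∸ a % v))) % v      ≡⟨ [m%n+k]%n≡[m+k]%n a (s + (v ∸ a % v)) v ⟨
    (a % v + (s + (v ∸ a % v))) % v  ≡⟨ cong (_% v) (x∙yz≈y∙xz (a % v) s _) ⟩
    (s + (a % v + (v ∸ a % v))) % v  ≡⟨ cong (λ x → (s + x) % v) (m+[n∸m]≡n (m%n≤n a v)) ⟩
    (s + v) % v                      ≡⟨ [m+n]%n≡m%n s v ⟩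
    s % v                            ∎
    where open ≡-Reasoning

  subℤ-+-< : ∀ {x t} → x + t < v → subℤ v x (x + t) ≡ negℤ v t
  subℤ-+-< {x} {t} x+t<v = begin
    (x % v + (v ∸ (x + t) % v)) % v  ≡⟨ cong₂ (λ y z → (y + (v ∸ z)) % v) (m<n⇒m%n≡m x<v) (m<n⇒m%n≡m x+t<v) ⟩
    (x + (v ∸ (x + t))) % v         ≡⟨ cong (_% v) (+-∸-assoc x (<⇒≤ x+t<v)) ⟨
    (x + v ∸ (x + t)) % v           ≡⟨ cong (_% v) ([m+n]∸[m+o]≡n∸o x v t) ⟩
    (v ∸ t) % v                     ∎
    where
    open ≡-Reasoning
    x<v : x < v
    x<v = ≤-<-trans (m≤m+n x t) x+t<v

  subℤ-≡0 : ∀ {a b} → a % v ≡ b % v → subℤ v a b ≡ 0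
  subℤ-≡0 {a} {b} a≡b = begin
    subℤ v a b                  ≡⟨ subℤ-% a b ⟨
    subℤ v (a % v) (b % v)      ≡⟨ cong (λ x → subℤ v x (b % v)) (trans a≡b (sym (+-identityʳ (b % v)))) ⟩
    subℤ v (b % v + 0) (b % v)  ≡⟨ subℤ-+ (b % v) 0 ⟩
    0 % v                       ≡⟨ m<n⇒m%n≡m (>-nonZero⁻¹ v) ⟩
    0                           ∎
    where open ≡-Reasoning

  negℤ-involutive : ∀ {t} → t < v → negℤ v (negℤ v t) ≡ t
  negℤ-involutive {zero}  _   = trans (cong (negℤ v) (n%n≡0 v)) (n%n≡0 v)
  negℤ-involutive {suc t} t<v = begin
    negℤ v ((v ∸ suc t) % v)  ≡⟨ cong (negℤ v) (m<n⇒m%n≡m (∸-monoʳ-< z<s (<⇒≤ t<v))) ⟩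
    (v ∸ (v ∸ suc t)) % v     ≡⟨ cong (_% v) (m∸[m∸n]≡n (<⇒≤ t<v)) ⟩
    suc t % v                 ≡⟨ m<n⇒m%n≡m t<v ⟩
    suc t                     ∎
    where open ≡-Reasoning

  negℤ-flip : ∀ {p q} → q < v → p ≡ negℤ v q → q ≡ negℤ v p
  negℤ-flip q<v p≡-q = trans (sym (negℤ-involutive q<v)) (cong (negℤ v) (sym p≡-q))

  subℤ-anticomm-+ : ∀ {x t} → x + t < v → subℤ v x (x + t) ≡ negℤ v (subℤ v (x + t) x)
  subℤ-anticomm-+ {x} {t} x+t<v = begin
    subℤ v x (x + t)           ≡⟨ subℤ-+-< x+t<v ⟩
    negℤ v t                   ≡⟨ cong (negℤ v) (m<n⇒m%n≡m (≤-<-trans (m≤n+m t x) x+t<v)) ⟨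
    negℤ v (t % v)             ≡⟨ cong (negℤ v) (subℤ-+ x t) ⟨
    negℤ v (subℤ v (x + t) x)  ∎
    where open ≡-Reasoning

  subℤ-anticomm : ∀ a b → subℤ v a b ≡ negℤ v (subℤ v b a)
  subℤ-anticomm a b = begin
    subℤ v a b                       ≡⟨ subℤ-% a b ⟨
    subℤ v (a % v) (b % v)           ≡⟨ anticomm-< (m%n<n a v) (m%n<n b v) ⟩
    negℤ v (subℤ v (b % v) (a % v))  ≡⟨ cong (negℤ v) (subℤ-% b a) ⟩
    negℤ v (subℤ v b a)              ∎
    where
    open ≡-Reasoning
    anticomm-< : ∀ {x y} → x < v → y < v → subℤ v x y ≡ negℤ v (subℤ v y x)
    anticomm-< {x} {y} x<v y<v with ≤-total x y
    ... | inj₁ x≤y with t , refl ← m≤n⇒∃[o]m+o≡n x≤y = subℤ-anticomm-+ y<v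
    ... | inj₂ y≤x with t , refl ← m≤n⇒∃[o]m+o≡n y≤x =
      negℤ-flip (subℤ<v (y + t) y) (subℤ-anticomm-+ x<v)

  Δ-comm-↭ : ∀ A B → Δ v A B ↭ map (negℤ v) (Δ v B A)
  Δ-comm-↭ A B = begin
    concatMap (λ a → map (λ b → subℤ v a b) B) A              ↭⟨ concatMap-map-comm-↭ (subℤ v) A B ⟩
    concatMap (λ b → map (λ a → subℤ v a b) A) B              ≡⟨ concatMap-cong (λ b → map-cong (λ a → subℤ-anticomm a b) A) B ⟩
    concatMap (λ b → map (λ a → negℤ v (subℤ v b a)) A) B     ≡⟨ concatMap-cong (λ b → map-∘ A) B ⟩
    concatMap (λ b → map (negℤ v) (map (subℤ v b) A)) B       ≡⟨ map-concatMap (negℤ v) _ B ⟨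
    map (negℤ v) (Δ v B A)                                    ∎
    where open PermutationReasoning

  Δ-grid : ∀ (f g : ℕ → ℕ → ℕ) js xs is ys →
           Δ v (concatMap (λ j → map (f j) xs) js) (concatMap (λ i → map (g i) ys) is)
             ≡ concatMap (λ j → concatMap (λ x → concatMap (λ i → map (λ y → subℤ v (f j x) (g i y)) ys) is) xs) js
  Δ-grid f g js xs is ys = begin
    concatMap (λ b → map (subℤ v b) G) (concatMap (λ j → map (f j) xs) js)
      ≡⟨ concatMap-concatMap _ _ js ⟩
    concatMap (λ j → concatMap (λ b → map (subℤ v b) G) (map (f j) xs)) js
      ≡⟨ concatMap-cong (λ j → concatMap-map _ (f j) xs) js ⟩
    concatMap (λ j → concatMap (λ x → map (subℤ v (f j x)) G) xs) js
      ≡⟨ concatMap-cong (λ j → concatMap-cong (λ x → map-G (subℤ v (f j x))) xs) js ⟩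
    concatMap (λ j → concatMap (λ x → concatMap (λ i → map (λ y → subℤ v (f j x) (g i y)) ys) is) xs) js
      ∎
    where
    open ≡-Reasoning
    G : List ℕ
    G = concatMap (λ i → map (g i) ys) is
    map-G : ∀ h → map h G ≡ concatMap (λ i → map (λ y → h (g i y)) ys) is
    map-G h = trans (map-concatMap h _ is) (concatMap-cong (λ i → sym (map-∘ ys)) is)

  ∈-Δ : ∀ {a b A B} → a ∈ A → b ∈ B → subℤ v a b ∈ Δ v A B
  ∈-Δ {B = B} a∈A b∈B = ∈-concatMap⁺ (λ a → map (subℤ v a) B) (Any.map (λ where refl → ∈-map⁺ _ b∈B) a∈A)

  0∉Δ⇒DisjointZ : ∀ {A B} → 0 ∉ Δ v B A → DisjointZ v A B
  0∉Δ⇒DisjointZ {A} {B} 0∉ a∈A b∈B a≡b = 0∉ (subst (_∈ Δ v B A) (subℤ-≡0 (sym a≡b)) (∈-Δ b∈B a∈A))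

  -- For a single b ∈ B, the differences b − a (a ∈ A) already separate the residues of A.
  Unique-Δ⇒Unique-% : ∀ A B → length A ≤ length B → Unique (Δ v B A) → Unique (map (_% v) A)
  Unique-Δ⇒Unique-% []        _       _  _    = []
  Unique-Δ⇒Unique-% (_ ∷ _)   []      () _
  Unique-Δ⇒Unique-% A@(_ ∷ _) (b ∷ _) _  uniq =
    Unique.map⁻ (subst Unique (map-∘ {g = λ r → (b % v + (v ∸ r)) % v} {f = _% v} A) (Unique-++⁻ˡ _ uniq))

  0∉nonzeroℤ : 0 ∉ nonzeroℤ v
  0∉nonzeroℤ 0∈ with ∈-map⁻ suc 0∈
  ... | _ , _ , ()

  Unique-nonzeroℤ : Unique (nonzeroℤ v)
  Unique-nonzeroℤ = Unique.map⁺ suc-injective (Unique.upTo⁺ (v ∸ 1))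

map-negℤ-nonzeroℤ : ∀ v .{{_ : NonZero v}} → map (negℤ v) (nonzeroℤ v) ↭ nonzeroℤ v
map-negℤ-nonzeroℤ v@(suc k) = begin
  map (negℤ v) (map suc (upTo k))       ≡⟨ map-∘ (upTo k) ⟨
  map (λ x → negℤ v (suc x)) (upTo k)   ≡⟨ map-cong-upTo k neg-suc ⟩
  map (λ x → suc (k ∸ suc x)) (upTo k)  ↭⟨ map-reflect-↭ suc k ⟩
  map suc (upTo k)                      ∎
  where
  open PermutationReasoning
  neg-suc : ∀ {x} → x < k → negℤ v (suc x) ≡ suc (k ∸ suc x)
  neg-suc {x} x<k = trans (m≤n⇒m%n≡m (m∸n≤m k x)) (+-∸-assoc 1 x<k)

map-suc-%-upTo : ∀ N → map (λ x → suc x % suc N) (upTo N) ≡ nonzeroℤ (suc N)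
map-suc-%-upTo N = map-cong-upTo N m≤n⇒m%n≡m

isClassicalSEDF-pair : ∀ v .{{_ : NonZero v}} {k A B} → length A ≡ k → length B ≡ k →
                       Δ v B A ↭ nonzeroℤ v → IsClassicalSEDF v 2 k 1 (A ∷ B ∷ [])
isClassicalSEDF-pair v {k} {A} {B} |A|≡k |B|≡k B-A = s≤s (s≤s z≤n) , kSubset , disjoint , differences
  where
  A-B : Δ v A B ↭ nonzeroℤ v
  A-B = begin
    Δ v A B                    ↭⟨ Δ-comm-↭ v A B ⟩
    map (negℤ v) (Δ v B A)     ↭⟨ map⁺ (negℤ v) B-A ⟩
    map (negℤ v) (nonzeroℤ v)  ↭⟨ map-negℤ-nonzeroℤ v ⟩
    nonzeroℤ v                 ∎
    where open PermutationReasoning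

  kSubset : ∀ i → IsKSubset v k (lookup (A ∷ B ∷ []) i)
  kSubset zero       = |A|≡k , Unique-Δ⇒Unique-% v A B (≤-reflexive (trans |A|≡k (sym |B|≡k)))
                                 (Unique-resp-↭ (↭-sym B-A) (Unique-nonzeroℤ v))
  kSubset (suc zero) = |B|≡k , Unique-Δ⇒Unique-% v B A (≤-reflexive (trans |B|≡k (sym |A|≡k)))
                                 (Unique-resp-↭ (↭-sym A-B) (Unique-nonzeroℤ v))

  disjoint : ∀ i j → i ≢ j → DisjointZ v (lookup (A ∷ B ∷ []) i) (lookup (A ∷ B ∷ []) j)
  disjoint zero       zero       i≢j = contradiction refl i≢j
  disjoint zero       (suc zero) _   = 0∉Δ⇒DisjointZ v (0∉nonzeroℤ v ∘ ∈-resp-↭ B-A)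
  disjoint (suc zero) zero       _   = 0∉Δ⇒DisjointZ v (0∉nonzeroℤ v ∘ ∈-resp-↭ A-B)
  disjoint (suc zero) (suc zero) i≢j = contradiction refl i≢j

  -- For m = 2 both sides compute to a single difference list followed by [].
  differences : ∀ i → otherDiffs v (A ∷ B ∷ []) i ↭ concat (replicate 1 (nonzeroℤ v))
  differences zero       = ++⁺ʳ [] A-B
  differences (suc zero) = ++⁺ʳ [] B-A

module Construction (h₁ h₂ h₃ h₄ : ℕ) where

  a : ℕ → ℕ → ℕ
  a i α = i * h₁ * h₂ + α

  b : ℕ → ℕ → ℕ
  b j β = j * h₁ * h₂ * h₃ + h₁ * h₂ * (h₃ ∸ 1) + β * h₁

  numeral : ℕ → ℕ → ℕ → ℕ → ℕ
  numeral j i β α = j * (h₃ * (h₂ * h₁)) + (i * (h₂ * h₁) + (β * h₁ + α))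

  b-a : ∀ j β {i α} → i < h₃ → α < h₁ → b j (suc β) ≡ a i α + suc (numeral j (h₃ ∸ suc i) β (h₁ ∸ suc α))
  b-a j β {i} {α} i<h₃ α<h₁ = b-a′ (m+[n∸m]≡n i<h₃) (m+[n∸m]≡n α<h₁)
    where
    -- Substituting h₁ = 1 + α + α′ and h₃ = 1 + i + i′ removes the truncated h₃ ∸ 1,
    -- leaving a ring identity.
    numeral-identity : ∀ h₂ j β i i′ α α′ →
      j * suc (α + α′) * h₂ * suc (i + i′) + suc (α + α′) * h₂ * (i + i′) + suc β * suc (α + α′)
        ≡ i * suc (α + α′) * h₂ + α
          + suc (j * (suc (i + i′) * (h₂ * suc (α + α′))) + (i′ * (h₂ * suc (α + α′)) + (β * suc (α + α′) + α′)))
    numeral-identity = solve-∀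
    b-a′ : ∀ {h₁ h₃ i′ α′} → suc (i + i′) ≡ h₃ → suc (α + α′) ≡ h₁ →
           j * h₁ * h₂ * h₃ + h₁ * h₂ * (h₃ ∸ 1) + suc β * h₁
             ≡ i * h₁ * h₂ + α + suc (j * (h₃ * (h₂ * h₁)) + (i′ * (h₂ * h₁) + (β * h₁ + α′)))
    b-a′ refl refl = numeral-identity h₂ j β i _ α _

  length-setA : length (setA h₁ h₂ h₃) ≡ h₃ * h₁
  length-setA = trans (length-concatMap-map a (upTo h₃) (upTo h₁)) (cong₂ _*_ (length-upTo h₃) (length-upTo h₁))

  length-setB : length (setB h₁ h₂ h₃ h₄) ≡ h₄ * h₂
  length-setB = trans (length-concatMap-map b (upTo h₄) (map suc (upTo h₂)))
                      (cong₂ _*_ (length-upTo h₄) (trans (length-map suc (upTo h₂)) (length-upTo h₂)))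

  h₄h₃h₂h₁≡[h₁h₃]² : h₁ * h₃ ≡ h₂ * h₄ → h₄ * (h₃ * (h₂ * h₁)) ≡ (h₁ * h₃) ^ 2
  h₄h₃h₂h₁≡[h₁h₃]² h₁h₃≡h₂h₄ = begin
    h₄ * (h₃ * (h₂ * h₁))            ≡⟨ regroup h₁ h₂ h₃ h₄ ⟩
    (h₁ * h₃) * (h₂ * h₄)            ≡⟨ cong ((h₁ * h₃) *_) h₁h₃≡h₂h₄ ⟨
    (h₁ * h₃) * (h₁ * h₃)            ≡⟨ cong ((h₁ * h₃) *_) (*-identityʳ (h₁ * h₃)) ⟨
    (h₁ * h₃) ^ 2                    ∎
    where
    open ≡-Reasoning
    regroup : ∀ h₁ h₂ h₃ h₄ → h₄ * (h₃ * (h₂ * h₁)) ≡ (h₁ * h₃) * (h₂ * h₄)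
    regroup = solve-∀

  module _ (v : ℕ) .{{_ : NonZero v}} where

    1+numeral : ℕ → ℕ → ℕ → ℕ → ℕ
    1+numeral j i β α = suc (numeral j i β α) % v

    Δ-row : ∀ j β → concatMap (λ i → map (λ α → subℤ v (b j (suc β)) (a i α)) (upTo h₁)) (upTo h₃)
                      ↭ concatMap (λ i → map (1+numeral j i β) (upTo h₁)) (upTo h₃)
    Δ-row j β = begin
      concatMap (λ i → map (λ α → subℤ v (b j (suc β)) (a i α)) (upTo h₁)) (upTo h₃)
        ≡⟨ concatMap-cong-upTo h₃ (λ i<h₃ → map-cong-upTo h₁ (λ α<h₁ → b-a-residue i<h₃ α<h₁)) ⟩
      concatMap (λ i → map (λ α → 1+numeral j (h₃ ∸ suc i) β (h₁ ∸ suc α)) (upTo h₁)) (upTo h₃)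
        ↭⟨ concatMap-cong-↭ (λ i → map-reflect-↭ (1+numeral j (h₃ ∸ suc i) β) h₁) (upTo h₃) ⟩
      concatMap (λ i → map (1+numeral j (h₃ ∸ suc i) β) (upTo h₁)) (upTo h₃)
        ↭⟨ concatMap-reflect-↭ (λ i → map (1+numeral j i β) (upTo h₁)) h₃ ⟩
      concatMap (λ i → map (1+numeral j i β) (upTo h₁)) (upTo h₃)
        ∎
      where
      open PermutationReasoning
      b-a-residue : ∀ {i α} → i < h₃ → α < h₁ → subℤ v (b j (suc β)) (a i α) ≡ 1+numeral j (h₃ ∸ suc i) β (h₁ ∸ suc α)
      b-a-residue {i} {α} i<h₃ α<h₁ =
        trans (cong (λ x → subℤ v x (a i α)) (b-a j β i<h₃ α<h₁)) (subℤ-+ v (a i α) _)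

    numerals-upTo : concatMap (λ j → concatMap (λ i → concatMap (λ β → map (1+numeral j i β) (upTo h₁)) (upTo h₂)) (upTo h₃)) (upTo h₄)
                      ≡ map (λ x → suc x % v) (upTo (h₄ * (h₃ * (h₂ * h₁))))
    numerals-upTo = begin
      concatMap (λ j → concatMap (λ i → concatMap (λ β → map (1+numeral j i β) (upTo h₁)) (upTo h₂)) (upTo h₃)) (upTo h₄)
        ≡⟨ concatMap-cong (λ j → concatMap-cong (λ i → concatMap-upTo-* (λ y → suc (j * (h₃ * (h₂ * h₁)) + (i * (h₂ * h₁) + y)) % v) h₁ h₂) (upTo h₃)) (upTo h₄) ⟩
      concatMap (λ j → concatMap (λ i → map (λ y → suc (j * (h₃ * (h₂ * h₁)) + (i * (h₂ * h₁) + y)) % v) (upTo (h₂ * h₁))) (upTo h₃)) (upTo h₄)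
        ≡⟨ concatMap-cong (λ j → concatMap-upTo-* (λ z → suc (j * (h₃ * (h₂ * h₁)) + z) % v) (h₂ * h₁) h₃) (upTo h₄) ⟩
      concatMap (λ j → map (λ z → suc (j * (h₃ * (h₂ * h₁)) + z) % v) (upTo (h₃ * (h₂ * h₁)))) (upTo h₄)
        ≡⟨ concatMap-upTo-* (λ x → suc x % v) (h₃ * (h₂ * h₁)) h₄ ⟩
      map (λ x → suc x % v) (upTo (h₄ * (h₃ * (h₂ * h₁))))
        ∎
      where open ≡-Reasoning

    Δ-setB-setA : Δ v (setB h₁ h₂ h₃ h₄) (setA h₁ h₂ h₃) ↭ map (λ x → suc x % v) (upTo (h₄ * (h₃ * (h₂ * h₁))))
    Δ-setB-setA = begin
      Δ v (setB h₁ h₂ h₃ h₄) (setA h₁ h₂ h₃)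
        ≡⟨ Δ-grid v b a (upTo h₄) (map suc (upTo h₂)) (upTo h₃) (upTo h₁) ⟩
      concatMap (λ j → concatMap (D j) (map suc (upTo h₂))) (upTo h₄)
        ≡⟨ concatMap-cong (λ j → concatMap-map (D j) suc (upTo h₂)) (upTo h₄) ⟩
      concatMap (λ j → concatMap (λ β → D j (suc β)) (upTo h₂)) (upTo h₄)
        ↭⟨ concatMap-cong-↭ (λ j → concatMap-cong-↭ (Δ-row j) (upTo h₂)) (upTo h₄) ⟩
      concatMap (λ j → concatMap (λ β → concatMap (λ i → map (1+numeral j i β) (upTo h₁)) (upTo h₃)) (upTo h₂)) (upTo h₄)
        ↭⟨ concatMap-cong-↭ (λ j → concatMap-comm-↭ (λ β i → map (1+numeral j i β) (upTo h₁)) (upTo h₂) (upTo h₃)) (upTo h₄) ⟩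
      concatMap (λ j → concatMap (λ i → concatMap (λ β → map (1+numeral j i β) (upTo h₁)) (upTo h₂)) (upTo h₃)) (upTo h₄)
        ≡⟨ numerals-upTo ⟩
      map (λ x → suc x % v) (upTo (h₄ * (h₃ * (h₂ * h₁))))
        ∎
      where
      open PermutationReasoning
      D : ℕ → ℕ → List ℕ
      D j β = concatMap (λ i → map (λ α → subℤ v (b j β) (a i α)) (upTo h₁)) (upTo h₃)

corollary6p4 : (h₁ h₂ h₃ h₄ : ℕ) → h₁ * h₃ ≡ h₂ * h₄ →
    IsClassicalSEDF (suc ((h₁ * h₃) ^ 2)) 2 (h₁ * h₃) 1
      (setA h₁ h₂ h₃ ∷ setB h₁ h₂ h₃ h₄ ∷ [])
corollary6p4 h₁ h₂ h₃ h₄ h₁h₃≡h₂h₄ =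
  isClassicalSEDF-pair v (trans length-setA (*-comm h₃ h₁))
                         (trans length-setB (trans (*-comm h₄ h₂) (sym h₁h₃≡h₂h₄))) B-A
  where
  open Construction h₁ h₂ h₃ h₄
  n v : ℕ
  n = h₁ * h₃
  v = suc (n ^ 2)
  B-A : Δ v (setB h₁ h₂ h₃ h₄) (setA h₁ h₂ h₃) ↭ nonzeroℤ v
  B-A = begin
    Δ v (setB h₁ h₂ h₃ h₄) (setA h₁ h₂ h₃)                ↭⟨ Δ-setB-setA v ⟩
    map (λ x → suc x % v) (upTo (h₄ * (h₃ * (h₂ * h₁))))  ≡⟨ cong (λ N → map (λ x → suc x % v) (upTo N)) (h₄h₃h₂h₁≡[h₁h₃]² h₁h₃≡h₂h₄) ⟩
    map (λ x → suc x % v) (upTo (n ^ 2))                  ≡⟨ map-suc-%-upTo (n ^ 2) ⟩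
    nonzeroℤ v                                            ∎
    where open PermutationReasoning
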